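{- Let $G$ be a finite simple graph with $n$ vertices such that $\varphi^{(4)}(G)\neq2$. Then $$\varphi(G)\geq\frac{n}{n-D_4(G)}.$$
   Context: Let $d(v)$ denote the degree of $v$. For nonempty $W\subseteq V(G)$ and natural $k$, $D_k(W)=\left(\frac{1}{|W|}\sum_{v\in W}d^k(v)\right)^{1/k}$ and $D_k(G)=D_k(V(G))$. $W$ is a small set if $d(v)\leq n-|W|$ for all $v\in W$; $W$ is a $\delta_k$-small set if $D_k(W)\leq n-|W|$. $\varphi(G)$ is the smallest natural number $r$ such that $V(G)$ is a disjoint union of $r$ small sets; $\varphi^{(4)}(G)$ is the smallest natural number $r$ such that $V(G)$ is a disjoint union of $r$ $\delta_4$-small sets. -}

module Defs where

open import Data.Nat using (ℕ; _+_; _*_; _∸_; _^_; _≤_; _<_)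
open import Data.Fin using (Fin; _≟_)
open import Data.Bool using (Bool; true; false; if_then_else_)
open import Data.List using (List; map; filter; length; allFin)
open import Data.Nat.ListAction using (sum)
open import Data.Product using (Σ; _×_; ∃)
open import Relation.Binary.PropositionalEquality using (_≡_)
open import Relation.Nullary using (¬_)

record Graph (n : ℕ) : Set where
  field
    adj   : Fin n → Fin n → Bool
    sym   : ∀ u v → adj u v ≡ adj v u
    irrefl : ∀ v → adj v v ≡ false
open Graph public

vertices : (n : ℕ) → List (Fin n)
vertices n = allFin n

deg : {n : ℕ} → Graph n → Fin n → ℕ
deg {n} G v = sum (map (λ u → if adj G v u then 1 else 0) (vertices n))

sumDeg4 : {n : ℕ} → Graph n → List (Fin n) → ℕ
sumDeg4 G W = sum (map (λ v → deg G v ^ 4) W)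

-- A partition of V(G) into r (nonempty) parts is a surjective map c : Fin n → Fin r;
-- part i is the list of vertices with colour i.
part : {n r : ℕ} → (Fin n → Fin r) → Fin r → List (Fin n)
part {n} c i = filter (λ v → c v ≟ i) (vertices n)

IsPartition : {n r : ℕ} → (Fin n → Fin r) → Set
IsPartition {n} {r} c = ∀ (i : Fin r) → ∃ λ (v : Fin n) → c v ≡ i

SmallPart : {n r : ℕ} → Graph n → (Fin n → Fin r) → Fin r → Set
SmallPart {n} G c i = ∀ v → c v ≡ i → deg G v ≤ n ∸ length (part c i)

-- W δ₄-small: D₄(W) ≤ n - |W|, i.e. (1/|W|) Σ_{v∈W} d⁴(v) ≤ (n-|W|)⁴ (both sides ≥ 0),
-- i.e. Σ_{v∈W} d⁴(v) ≤ |W| · (n-|W|)⁴  (W nonempty).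
Delta4SmallPart : {n r : ℕ} → Graph n → (Fin n → Fin r) → Fin r → Set
Delta4SmallPart {n} G c i =
  sumDeg4 G (part c i) ≤ length (part c i) * (n ∸ length (part c i)) ^ 4

SmallPartition : {n : ℕ} → Graph n → ℕ → Set
SmallPartition {n} G r = Σ (Fin n → Fin r) λ c → IsPartition c × (∀ i → SmallPart G c i)

Delta4Partition : {n : ℕ} → Graph n → ℕ → Set
Delta4Partition {n} G r = Σ (Fin n → Fin r) λ c → IsPartition c × (∀ i → Delta4SmallPart G c i)

IsPhi : {n : ℕ} → Graph n → ℕ → Set
IsPhi G r = SmallPartition G r × (∀ s → s < r → ¬ SmallPartition G s)

IsPhi4 : {n : ℕ} → Graph n → ℕ → Set
IsPhi4 G r = Delta4Partition G r × (∀ s → s < r → ¬ Delta4Partition G s)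

{-# OPTIONS --safe #-}
-- A small partition into r = φ(G) parts of sizes x₁, …, x_r is also δ₄-small, so
-- Σ d⁴(v) ≤ Σ f(xᵢ) with f(x) = x (n − x)⁴ and Σ xᵢ = n.  For r ≥ 4, f lies below its
-- tangent at n/r on all of [0, n], so Σ f(xᵢ) ≤ r f(n/r) = n⁵ (r − 1)⁴ / r⁴.  For r = 3 the
-- tangent bound only holds on [0, n/2]; a part larger than n/2 is handled by the cruder
-- bounds f ≤ f(n/2) on [n/2, n] and f ≤ f(n/5).  For r = 2 the bound can fail, but φ(G) = 2
-- forces φ⁽⁴⁾(G) = 2: a δ₄-small set containing every vertex has only isolated vertices.
-- Most polynomial inequalities L ≤ R are certified by identities R − L = (u − v)² Q with Q ≥ 0.
module Submission where

open import Defs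
open import Data.Nat using (ℕ; _*_; _∸_; _^_; _≤_; NonZero)
open import Relation.Binary.PropositionalEquality using (_≢_)
open import Data.Fin using (Fin)

open import Data.Bool using (true; false; if_then_else_)
open import Data.Empty using (⊥-elim)
open import Data.Fin using (zero; suc; _≟_)
open import Data.Fin.Properties using (¬Fin0)
open import Data.List using (List; []; _∷_; map; filter; length; allFin; tabulate)
open import Data.List.Properties using (map-cong; map-∘; map-tabulate; length-map; length-tabulate)
open import Data.List.Membership.Propositional using (_∈_)
open import Data.List.Membership.Propositional.Properties using (∈-allFin; ∈-filter⁺)
open import Data.List.Relation.Unary.All as All using (All; []; _∷_)
open import Data.List.Relation.Unary.All.Properties using (all-filter)
open import Data.List.Relation.Unary.Any using (here; there)
open import Data.Nat using (zero; suc; _+_; _<_; z≤n; s≤s; _≤?_)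
open import Data.Nat.ListAction using (sum)
open import Data.Nat.Properties hiding (_≟_)
open import Data.Nat.Solver using (module +-*-Solver)
open import Data.Nat.Tactic.RingSolver using (solve-∀)
open import Data.Product using (_,_)
open import Data.Sum using ([_,_]′)
open import Relation.Nullary using (¬_; does; yes; no)
open import Relation.Binary.PropositionalEquality using (_≡_; refl; trans; cong; cong₂; subst; subst₂)
import Relation.Binary.PropositionalEquality as ≡

open +-*-Solver using (solve; _:=_; _:+_; _:*_; _:^_; con)
open ≤-Reasoning

sum-map-const : ∀ {A : Set} (k : ℕ) (xs : List A) → sum (map (λ _ → k) xs) ≡ length xs * k
sum-map-const k []       = refl
sum-map-const k (x ∷ xs) = cong (k +_) (sum-map-const k xs)

sum-map-*ˡ : ∀ (k : ℕ) (xs : List ℕ) → sum (map (k *_) xs) ≡ k * sum xs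
sum-map-*ˡ k []       = ≡.sym (*-zeroʳ k)
sum-map-*ˡ k (x ∷ xs) = trans (cong (k * x +_) (sum-map-*ˡ k xs)) (≡.sym (*-distribˡ-+ k x (sum xs)))

sum-map-+ : ∀ {A : Set} (f g : A → ℕ) (xs : List A) →
  sum (map (λ x → f x + g x) xs) ≡ sum (map f xs) + sum (map g xs)
sum-map-+ f g []       = refl
sum-map-+ f g (x ∷ xs) =
  trans (cong (f x + g x +_) (sum-map-+ f g xs)) (interchange (f x) (g x) (sum (map f xs)) (sum (map g xs)))
  where
  interchange : ∀ a b c d → a + b + (c + d) ≡ a + c + (b + d)
  interchange = solve-∀

sum-map-affine : ∀ (p u : ℕ) (xs : List ℕ) → sum (map (λ x → p * x + u) xs) ≡ p * sum xs + length xs * u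
sum-map-affine p u xs = trans (sum-map-+ (p *_) (λ _ → u) xs) (cong₂ _+_ (sum-map-*ˡ p xs) (sum-map-const u xs))

sum-map-mono : ∀ {A : Set} {f g : A → ℕ} {xs : List A} →
  All (λ x → f x ≤ g x) xs → sum (map f xs) ≤ sum (map g xs)
sum-map-mono []           = z≤n
sum-map-mono (fx≤gx ∷ ps) = +-mono-≤ fx≤gx (sum-map-mono ps)

≤-sum-map : ∀ {A : Set} (f : A → ℕ) {x : A} {xs : List A} → x ∈ xs → f x ≤ sum (map f xs)
≤-sum-map f {xs = y ∷ xs} (here refl) = m≤m+n (f y) (sum (map f xs))
≤-sum-map f {xs = y ∷ xs} (there x∈xs) = ≤-trans (≤-sum-map f x∈xs) (m≤n+m _ (f y))

All-≤-sum : ∀ (xs : List ℕ) → All (_≤ sum xs) xs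
All-≤-sum []       = []
All-≤-sum (x ∷ xs) = m≤m+n x (sum xs) ∷ All.map (λ y≤ → ≤-trans y≤ (m≤n+m (sum xs) x)) (All-≤-sum xs)

sum-swap : ∀ (x y : ℕ) (zs : List ℕ) → sum (x ∷ y ∷ zs) ≡ sum (y ∷ x ∷ zs)
sum-swap x y zs = trans (≡.sym (+-assoc x y (sum zs))) (trans (cong (_+ sum zs) (+-comm x y)) (+-assoc y x (sum zs)))

sum-map-indicator : ∀ {r} (j : Fin r) (w : ℕ) →
  sum (map (λ i → if does (j ≟ i) then w else 0) (allFin r)) ≡ w
sum-map-indicator {r} j w =
  trans (cong sum (map-tabulate {n = r} (λ i → i) (λ i → if does (j ≟ i) then w else 0))) (indicator j)
  where
  zeros : ∀ r → sum (tabulate {n = r} (λ _ → 0)) ≡ 0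
  zeros zero    = refl
  zeros (suc r) = zeros r
  indicator : ∀ {r} (j : Fin r) → sum (tabulate (λ i → if does (j ≟ i) then w else 0)) ≡ w
  indicator {suc r} zero    = trans (cong (w +_) (zeros r)) (+-identityʳ w)
  indicator {suc r} (suc j) = indicator j

sum-map-partition : ∀ {A : Set} {r} (c : A → Fin r) (g : A → ℕ) (xs : List A) →
  sum (map g xs) ≡ sum (map (λ i → sum (map g (filter (λ x → c x ≟ i) xs))) (allFin r))
sum-map-partition {r = r} c g []       = ≡.sym (trans (sum-map-const 0 (allFin r)) (*-zeroʳ (length (allFin r))))
sum-map-partition {A} {r} c g (x ∷ xs) = begin-equality
  g x + sum (map g xs)
    ≡⟨ cong₂ _+_ (≡.sym (sum-map-indicator (c x) (g x))) (sum-map-partition c g xs) ⟩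
  sum (map indicator (allFin r)) + sum (map (classSum xs) (allFin r))
    ≡⟨ sum-map-+ indicator (classSum xs) (allFin r) ⟨
  sum (map (λ i → indicator i + classSum xs i) (allFin r))
    ≡⟨ cong sum (map-cong step (allFin r)) ⟩
  sum (map (classSum (x ∷ xs)) (allFin r)) ∎
  where
  indicator : Fin r → ℕ
  indicator i = if does (c x ≟ i) then g x else 0
  classSum : List A → Fin r → ℕ
  classSum ys i = sum (map g (filter (λ y → c y ≟ i) ys))
  step : ∀ i → indicator i + classSum xs i ≡ classSum (x ∷ xs) i
  step i with does (c x ≟ i)
  ... | true  = refl
  ... | false = refl

-- Capacity of a vertex set

capacity : ℕ → ℕ → ℕ
capacity n x = x * (n ∸ x) ^ 4

capacity-self : ∀ n → capacity n n ≡ 0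
capacity-self n = trans (cong (λ m → n * m ^ 4) (n∸n≡0 n)) (*-zeroʳ n)

capacity-elim : (P : ℕ → ℕ → ℕ → Set) → (∀ a b → P (a + b) a (a * b ^ 4)) →
  ∀ {n x} → x ≤ n → P n x (capacity n x)
capacity-elim P h {n} {x} x≤n = subst (λ m → P m x (capacity n x)) (m+[n∸m]≡n x≤n) (h x (n ∸ x))

partSizes : ∀ {n r} → (Fin n → Fin r) → List ℕ
partSizes {r = r} c = map (λ i → length (part c i)) (allFin r)

length-partSizes : ∀ {n r} (c : Fin n → Fin r) → length (partSizes c) ≡ r
length-partSizes {r = r} c = trans (length-map _ (allFin r)) (length-tabulate (λ i → i))

sum-partSizes : ∀ {n r} (c : Fin n → Fin r) → sum (partSizes c) ≡ n
sum-partSizes {n} {r} c = begin-equality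
  sum (partSizes c)
    ≡⟨ cong sum (map-cong (λ i → count (part c i)) (allFin r)) ⟨
  sum (map (λ i → sum (map (λ _ → 1) (part c i))) (allFin r))
    ≡⟨ sum-map-partition c (λ _ → 1) (vertices n) ⟨
  sum (map (λ _ → 1) (vertices n))
    ≡⟨ count (vertices n) ⟩
  length (vertices n)
    ≡⟨ length-tabulate (λ i → i) ⟩
  n ∎
  where
  count : (vs : List (Fin n)) → sum (map (λ _ → 1) vs) ≡ length vs
  count vs = trans (sum-map-const 1 vs) (*-identityʳ (length vs))

small⇒δ₄-small : ∀ {n r} (G : Graph n) {c : Fin n → Fin r} {i : Fin r} →
  SmallPart G c i → Delta4SmallPart G c i
small⇒δ₄-small {n} G {c} {i} small = begin
  sumDeg4 G (part c i)
    ≤⟨ sum-map-mono (All.map (λ {v} cv≡i → ^-monoˡ-≤ 4 (small v cv≡i)) (all-filter (λ v → c v ≟ i) (allFin n))) ⟩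
  sum (map (λ _ → (n ∸ length (part c i)) ^ 4) (part c i))
    ≡⟨ sum-map-const _ (part c i) ⟩
  length (part c i) * (n ∸ length (part c i)) ^ 4 ∎

sumDeg4≤sum-capacity : ∀ {n r} (G : Graph n) (c : Fin n → Fin r) → (∀ i → SmallPart G c i) →
  sumDeg4 G (vertices n) ≤ sum (map (capacity n) (partSizes c))
sumDeg4≤sum-capacity {n} {r} G c small = begin
  sumDeg4 G (vertices n)
    ≡⟨ sum-map-partition c (λ v → deg G v ^ 4) (vertices n) ⟩
  sum (map (λ i → sumDeg4 G (part c i)) (allFin r))
    ≤⟨ sum-map-mono (All.universal (λ i → small⇒δ₄-small G (small i)) (allFin r)) ⟩
  sum (map (λ i → capacity n (length (part c i))) (allFin r))
    ≡⟨ cong sum (map-∘ (allFin r)) ⟩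
  sum (map (capacity n) (partSizes c)) ∎

δ₄-small-spanning⇒isolated : ∀ {n r} (G : Graph n) {c : Fin n → Fin r} {i : Fin r} →
  Delta4SmallPart G c i → length (part c i) ≡ n → ∀ {v} → c v ≡ i → deg G v ≡ 0
δ₄-small-spanning⇒isolated {n} G {c} {i} δ₄ spanning {v} cv≡i = m^n≡0⇒m≡0 (deg G v) 4 (n≤0⇒n≡0 (begin
  deg G v ^ 4
    ≤⟨ ≤-sum-map (λ u → deg G u ^ 4) (∈-filter⁺ (λ u → c u ≟ i) (∈-allFin v) cv≡i) ⟩
  sumDeg4 G (part c i)
    ≤⟨ δ₄ ⟩
  capacity n (length (part c i))
    ≡⟨ cong (capacity n) spanning ⟩
  capacity n n
    ≡⟨ capacity-self n ⟩
  0 ∎))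

φ≡2⇒φ⁴≡2 : ∀ {n} .{{_ : NonZero n}} (G : Graph n) → IsPhi G 2 → IsPhi4 G 2
φ≡2⇒φ⁴≡2 {n@(suc _)} G ((c , onto , small) , minimal) = (c , onto , λ i → small⇒δ₄-small G (small i)) , no-smaller
  where
  no-smaller : ∀ s → s < 2 → ¬ Delta4Partition G s
  no-smaller 0 _ (c₀ , _) = ¬Fin0 (c₀ zero)
  no-smaller 1 _ (c₁ , onto₁ , δ₄) = minimal 1 (s≤s (s≤s z≤n)) (c₁ , onto₁ , isolated)
    where
    isolated : ∀ i → SmallPart G c₁ i
    isolated zero v c₁v≡0 =
      subst (_≤ n ∸ length (part c₁ zero)) (≡.sym (δ₄-small-spanning⇒isolated G {c₁} (δ₄ zero) spanning c₁v≡0)) z≤n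
      where
      spanning : length (part c₁ zero) ≡ n
      spanning = trans (≡.sym (+-identityʳ _)) (sum-partSizes c₁)
  no-smaller (suc (suc _)) (s≤s (s≤s ()))

-- Polynomial inequalities

2*m*n≤m²+n² : ∀ m n → 2 * m * n ≤ m ^ 2 + n ^ 2
2*m*n≤m²+n² m n = [ ordered m n , (λ n≤m → subst₂ _≤_ (swap n m) (+-comm (n ^ 2) (m ^ 2)) (ordered n m n≤m)) ]′ (≤-total m n)
  where
  ordered : ∀ m n → m ≤ n → 2 * m * n ≤ m ^ 2 + n ^ 2
  ordered m n m≤n with m≤n⇒∃[o]m+o≡n m≤n
  ... | d , refl = m+n≤o⇒m≤o _ (≤-reflexive (solve 2 (λ m d → con 2 :* m :* (m :+ d) :+ d :^ 2 := m :^ 2 :+ (m :+ d) :^ 2) refl m d))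
  swap : ∀ m n → 2 * m * n ≡ 2 * n * m
  swap = solve-∀

≤-of-square-gap : ∀ {L R} u v {Q} → R + 2 * u * v * Q ≡ L + (u ^ 2 + v ^ 2) * Q → L ≤ R
≤-of-square-gap {L} {R} u v {Q} eq = +-cancelʳ-≤ (2 * u * v * Q) L R (begin
  L + 2 * u * v * Q         ≤⟨ +-monoʳ-≤ L (*-monoˡ-≤ Q (2*m*n≤m²+n² u v)) ⟩
  L + (u ^ 2 + v ^ 2) * Q   ≡⟨ eq ⟨
  R + 2 * u * v * Q         ∎)

capacity-≤-max : ∀ {n x} → x ≤ n → 5 ^ 5 * capacity n x ≤ 4 ^ 4 * n ^ 5
capacity-≤-max = capacity-elim (λ n _ f → 5 ^ 5 * f ≤ 4 ^ 4 * n ^ 5) λ a b →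
  ≤-of-square-gap (4 * a) b (solve 2 (λ a b →
    let Q = con 256 :* b :^ 3 :+ con 203 :* a :* b :^ 2 :+ con 88 :* a :^ 2 :* b :+ con 16 :* a :^ 3
    in  con 256 :* (a :+ b) :^ 5 :+ con 2 :* (con 4 :* a) :* b :* Q
        := con 3125 :* (a :* b :^ 4) :+ ((con 4 :* a) :^ 2 :+ b :^ 2) :* Q) refl a b)

capacity-≤-of-large : ∀ {n x} → n ≤ 2 * x → x ≤ n → 2 ^ 5 * capacity n x ≤ n ^ 5
capacity-≤-of-large n≤2x x≤n = capacity-elim (λ n x f → n ≤ 2 * x → 2 ^ 5 * f ≤ n ^ 5) bound x≤n n≤2x
  where
  bound : ∀ a b → a + b ≤ 2 * a → 2 ^ 5 * (a * b ^ 4) ≤ (a + b) ^ 5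
  bound a b a+b≤2a with m≤n⇒∃[o]m+o≡n (≤-trans (+-cancelˡ-≤ a b (a + 0) a+b≤2a) (≤-reflexive (+-identityʳ a)))
  ... | d , refl = m+n≤o⇒m≤o _ (≤-reflexive (solve 2 (λ b d →
          con 32 :* ((b :+ d) :* b :^ 4)
            :+ (con 48 :* b :^ 4 :* d :+ con 80 :* b :^ 3 :* d :^ 2 :+ con 40 :* b :^ 2 :* d :^ 3 :+ con 10 :* b :* d :^ 4 :+ d :^ 5)
          := (b :+ d :+ b) :^ 5) refl b d))

-- 3⁵ f(x) ≤ 3⁵ (f(n/3) + f′(n/3) (x − n/3)) for f = capacity n, valid on [0, n/2].
capacity-tangent-3 : ∀ {n x} → 2 * x ≤ n →
  3 ^ 5 * capacity n x + 16 * n ^ 4 * (3 * x) ≤ 2 ^ 4 * n ^ 5 + 16 * n ^ 4 * n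
capacity-tangent-3 {x = x} 2x≤n = capacity-elim
  (λ n x f → 2 * x ≤ n → 3 ^ 5 * f + 16 * n ^ 4 * (3 * x) ≤ 2 ^ 4 * n ^ 5 + 16 * n ^ 4 * n)
  bound (≤-trans (m≤m+n x (x + 0)) 2x≤n) 2x≤n
  where
  bound : ∀ a b → 2 * a ≤ a + b →
    3 ^ 5 * (a * b ^ 4) + 16 * (a + b) ^ 4 * (3 * a) ≤ 2 ^ 4 * (a + b) ^ 5 + 16 * (a + b) ^ 4 * (a + b)
  bound a b 2a≤a+b with m≤n⇒∃[o]m+o≡n (≤-trans (≤-reflexive (≡.sym (+-identityʳ a))) (+-cancelˡ-≤ a (a + 0) b 2a≤a+b))
  ... | d , refl = ≤-of-square-gap a d (solve 2 (λ a d →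
          let n = a :+ (a :+ d)
              Q = con 32 :* d :^ 3 :+ con 93 :* a :* d :^ 2 :+ con 78 :* a :^ 2 :* d :+ con 13 :* a :^ 3
          in  con 16 :* n :^ 5 :+ con 16 :* n :^ 4 :* n :+ con 2 :* a :* d :* Q
              := con 243 :* (a :* (a :+ d) :^ 4) :+ con 16 :* n :^ 4 :* (con 3 :* a) :+ (a :^ 2 :+ d :^ 2) :* Q) refl a d)

-- r⁵ f(x) ≤ r⁵ (f(n/r) + f′(n/r) (x − n/r)) for r = 4 + s, valid on all of [0, n]; the linear
-- term n⁴ (r − 1)³ (r − 5) (r x − n) is split into two nonnegative parts.
capacity-tangent-≥4 : ∀ s {n x} → x ≤ n →
  (4 + s) ^ 5 * capacity n x + n ^ 4 * (3 + s) ^ 3 * ((4 + s) * x + s * n)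
    ≤ n ^ 5 * (3 + s) ^ 4 + n ^ 4 * (3 + s) ^ 3 * (s * (4 + s) * x + n)
capacity-tangent-≥4 s = capacity-elim
  (λ n x f → (4 + s) ^ 5 * f + n ^ 4 * (3 + s) ^ 3 * ((4 + s) * x + s * n)
               ≤ n ^ 5 * (3 + s) ^ 4 + n ^ 4 * (3 + s) ^ 3 * (s * (4 + s) * x + n))
  λ a b → ≤-of-square-gap ((3 + s) * a) b (solve 3 (λ a b s →
    let n = a :+ b
        t = con 3 :+ s
        r = con 4 :+ s
        Q = con 4 :* b :^ 3 :* t :^ 3
            :+ a :* b :^ 2 :* (con 56 :+ con 97 :* s :+ con 44 :* s :^ 2 :+ con 6 :* s :^ 3)
            :+ con 2 :* a :^ 2 :* b :* (con 6 :+ con 23 :* s :+ con 13 :* s :^ 2 :+ con 2 :* s :^ 3)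
            :+ a :^ 3 :* s :* t :^ 2
    in  n :^ 5 :* t :^ 4 :+ n :^ 4 :* t :^ 3 :* (s :* r :* a :+ n) :+ con 2 :* (t :* a) :* b :* Q
        := r :^ 5 :* (a :* b :^ 4) :+ n :^ 4 :* t :^ 3 :* (r :* a :+ s :* n) :+ ((t :* a) :^ 2 :+ b :^ 2) :* Q)
    refl a b s)

sum-≤-of-tangent-lines : ∀ (F P Q : ℕ → ℕ) (K A C : ℕ) (xs : List ℕ) →
  All (λ x → K * F x + A * P x ≤ C + A * Q x) xs →
  sum (map P xs) ≡ sum (map Q xs) →
  K * sum (map F xs) ≤ length xs * C
sum-≤-of-tangent-lines F P Q K A C xs tangents balanced = +-cancelʳ-≤ (A * sum (map P xs)) _ _ (begin
  K * sum (map F xs) + A * sum (map P xs)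
    ≡⟨ cong₂ _+_ (scale K F) (scale A P) ⟨
  sum (map (λ x → K * F x) xs) + sum (map (λ x → A * P x) xs)
    ≡⟨ sum-map-+ (λ x → K * F x) (λ x → A * P x) xs ⟨
  sum (map (λ x → K * F x + A * P x) xs)
    ≤⟨ sum-map-mono tangents ⟩
  sum (map (λ x → C + A * Q x) xs)
    ≡⟨ sum-map-+ (λ _ → C) (λ x → A * Q x) xs ⟩
  sum (map (λ _ → C) xs) + sum (map (λ x → A * Q x) xs)
    ≡⟨ cong₂ _+_ (sum-map-const C xs) (trans (scale A Q) (cong (A *_) (≡.sym balanced))) ⟩
  length xs * C + A * sum (map P xs) ∎)
  where
  scale : ∀ k G → sum (map (λ x → k * G x) xs) ≡ k * sum (map G xs)
  scale k G = trans (cong sum (map-∘ xs)) (sum-map-*ˡ k (map G xs))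

sum-capacity-≥4 : ∀ s {n} (xs : List ℕ) → length xs ≡ 4 + s → sum xs ≡ n →
  (4 + s) ^ 4 * sum (map (capacity n) xs) ≤ n ^ 5 * (3 + s) ^ 4
sum-capacity-≥4 s {n} xs len Σ≡n = *-cancelˡ-≤ (4 + s) (begin
  (4 + s) * ((4 + s) ^ 4 * sum (map (capacity n) xs))
    ≡⟨ *-assoc (4 + s) ((4 + s) ^ 4) (sum (map (capacity n) xs)) ⟨
  (4 + s) ^ 5 * sum (map (capacity n) xs)
    ≤⟨ sum-≤-of-tangent-lines (capacity n) P Q ((4 + s) ^ 5) (n ^ 4 * (3 + s) ^ 3) (n ^ 5 * (3 + s) ^ 4) xs
         (All.map (capacity-tangent-≥4 s) bounded) balanced ⟩
  length xs * (n ^ 5 * (3 + s) ^ 4)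
    ≡⟨ cong (_* (n ^ 5 * (3 + s) ^ 4)) len ⟩
  (4 + s) * (n ^ 5 * (3 + s) ^ 4) ∎)
  where
  P Q : ℕ → ℕ
  P x = (4 + s) * x + s * n
  Q x = s * (4 + s) * x + n
  bounded : All (_≤ n) xs
  bounded = subst (λ m → All (_≤ m) xs) Σ≡n (All-≤-sum xs)
  regroup : ∀ s n → (4 + s) * n + (4 + s) * (s * n) ≡ s * (4 + s) * n + (4 + s) * n
  regroup = solve-∀
  balanced : sum (map P xs) ≡ sum (map Q xs)
  balanced = begin-equality
    sum (map P xs)                          ≡⟨ sum-map-affine (4 + s) (s * n) xs ⟩
    (4 + s) * sum xs + length xs * (s * n)  ≡⟨ cong₂ (λ m l → (4 + s) * m + l * (s * n)) Σ≡n len ⟩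
    (4 + s) * n + (4 + s) * (s * n)         ≡⟨ regroup s n ⟩
    s * (4 + s) * n + (4 + s) * n           ≡⟨ cong₂ (λ m l → s * (4 + s) * m + l * n) Σ≡n len ⟨
    s * (4 + s) * sum xs + length xs * n    ≡⟨ sum-map-affine (s * (4 + s)) n xs ⟨
    sum (map Q xs)                          ∎

sum-capacity-3-small : ∀ {n a b c} → 2 * a ≤ n → 2 * b ≤ n → 2 * c ≤ n → sum (a ∷ b ∷ c ∷ []) ≡ n →
  3 ^ 4 * sum (map (capacity n) (a ∷ b ∷ c ∷ [])) ≤ n ^ 5 * 2 ^ 4
sum-capacity-3-small {n} {a} {b} {c} 2a≤n 2b≤n 2c≤n Σ≡n = *-cancelˡ-≤ 3 (begin
  3 * (3 ^ 4 * sum (map (capacity n) xs))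
    ≡⟨ *-assoc 3 (3 ^ 4) (sum (map (capacity n) xs)) ⟨
  3 ^ 5 * sum (map (capacity n) xs)
    ≤⟨ sum-≤-of-tangent-lines (capacity n) (3 *_) (λ _ → n) (3 ^ 5) (16 * n ^ 4) (2 ^ 4 * n ^ 5) xs tangents balanced ⟩
  3 * (2 ^ 4 * n ^ 5)
    ≡⟨ cong (3 *_) (*-comm (2 ^ 4) (n ^ 5)) ⟩
  3 * (n ^ 5 * 2 ^ 4) ∎)
  where
  xs : List ℕ
  xs = a ∷ b ∷ c ∷ []
  tangents : All (λ x → 3 ^ 5 * capacity n x + 16 * n ^ 4 * (3 * x) ≤ 2 ^ 4 * n ^ 5 + 16 * n ^ 4 * n) xs
  tangents = capacity-tangent-3 {x = a} 2a≤n ∷ capacity-tangent-3 {x = b} 2b≤n ∷ capacity-tangent-3 {x = c} 2c≤n ∷ []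
  balanced : sum (map (3 *_) xs) ≡ sum (map (λ _ → n) xs)
  balanced = trans (sum-map-*ˡ 3 xs) (trans (cong (3 *_) Σ≡n) (≡.sym (sum-map-const n xs)))

sum-capacity-3-large : ∀ {n a b c} → n ≤ 2 * a → a ≤ n → b ≤ n → c ≤ n →
  3 ^ 4 * sum (map (capacity n) (a ∷ b ∷ c ∷ [])) ≤ n ^ 5 * 2 ^ 4
sum-capacity-3-large {n} {a} {b} {c} n≤2a a≤n b≤n c≤n =
  combine (n ^ 5) (capacity n a) (capacity n b) (capacity n c)
    (capacity-≤-of-large n≤2a a≤n) (capacity-≤-max b≤n) (capacity-≤-max c≤n)
  where
  spread : ∀ k p q r → k * (p + (q + (r + 0))) ≡ k * p + (k * q + k * r)
  spread = solve-∀
  gather : ∀ a b N → a * N + (b * N + b * N) ≡ (a + (b + b)) * N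
  gather = solve-∀
  -- 3⁴ (2⁻⁵ + 2 · 4⁴ / 5⁵) = 1580229 / 10⁵ < 2⁴
  combine : ∀ N p q r → 2 ^ 5 * p ≤ N → 5 ^ 5 * q ≤ 4 ^ 4 * N → 5 ^ 5 * r ≤ 4 ^ 4 * N →
    3 ^ 4 * (p + (q + (r + 0))) ≤ N * 2 ^ 4
  combine N p q r hp hq hr = *-cancelˡ-≤ 100000 (begin
    100000 * (3 ^ 4 * (p + (q + (r + 0))))
      ≡⟨ *-assoc 100000 (3 ^ 4) (p + (q + (r + 0))) ⟨
    8100000 * (p + (q + (r + 0)))
      ≡⟨ spread 8100000 p q r ⟩
    8100000 * p + (8100000 * q + 8100000 * r)
      ≡⟨ cong₂ _+_ (*-assoc 253125 (2 ^ 5) p) (cong₂ _+_ (*-assoc 2592 (5 ^ 5) q) (*-assoc 2592 (5 ^ 5) r)) ⟩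
    253125 * (2 ^ 5 * p) + (2592 * (5 ^ 5 * q) + 2592 * (5 ^ 5 * r))
      ≤⟨ +-mono-≤ (*-monoʳ-≤ 253125 hp) (+-mono-≤ (*-monoʳ-≤ 2592 hq) (*-monoʳ-≤ 2592 hr)) ⟩
    253125 * N + (2592 * (4 ^ 4 * N) + 2592 * (4 ^ 4 * N))
      ≡⟨ cong (λ t → 253125 * N + (t + t)) (*-assoc 2592 (4 ^ 4) N) ⟨
    253125 * N + (663552 * N + 663552 * N)
      ≡⟨ gather 253125 663552 N ⟩
    1580229 * N
      ≤⟨ *-monoˡ-≤ N (m≤m+n 1580229 19771) ⟩
    1600000 * N
      ≡⟨ *-assoc 100000 (2 ^ 4) N ⟩
    100000 * (2 ^ 4 * N)
      ≡⟨ cong (100000 *_) (*-comm (2 ^ 4) N) ⟩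
    100000 * (N * 2 ^ 4) ∎)

sum-capacity-3 : ∀ {n} a b c → sum (a ∷ b ∷ c ∷ []) ≡ n →
  3 ^ 4 * sum (map (capacity n) (a ∷ b ∷ c ∷ [])) ≤ n ^ 5 * 2 ^ 4
sum-capacity-3 {n} a b c Σ≡n
  with subst (λ m → All (_≤ m) (a ∷ b ∷ c ∷ [])) Σ≡n (All-≤-sum (a ∷ b ∷ c ∷ [])) | 2 * a ≤? n | 2 * b ≤? n | 2 * c ≤? n
... | _ | yes 2a≤n | yes 2b≤n | yes 2c≤n = sum-capacity-3-small {a = a} {b} {c} 2a≤n 2b≤n 2c≤n Σ≡n
... | a≤n ∷ b≤n ∷ c≤n ∷ [] | no 2a≰n | _ | _ = sum-capacity-3-large {a = a} {b} {c} (<⇒≤ (≰⇒> 2a≰n)) a≤n b≤n c≤n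
... | a≤n ∷ b≤n ∷ c≤n ∷ [] | yes _ | no 2b≰n | _ = begin
  3 ^ 4 * sum (map (capacity n) (a ∷ b ∷ c ∷ []))
    ≡⟨ cong (3 ^ 4 *_) (sum-swap (capacity n a) (capacity n b) (capacity n c ∷ [])) ⟩
  3 ^ 4 * sum (map (capacity n) (b ∷ a ∷ c ∷ []))
    ≤⟨ sum-capacity-3-large {a = b} {a} {c} (<⇒≤ (≰⇒> 2b≰n)) b≤n a≤n c≤n ⟩
  n ^ 5 * 2 ^ 4 ∎
... | a≤n ∷ b≤n ∷ c≤n ∷ [] | yes _ | yes _ | no 2c≰n = begin
  3 ^ 4 * sum (map (capacity n) (a ∷ b ∷ c ∷ []))
    ≡⟨ cong (3 ^ 4 *_) (trans (cong (capacity n a +_) (sum-swap (capacity n b) (capacity n c) []))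
                              (sum-swap (capacity n a) (capacity n c) (capacity n b ∷ []))) ⟩
  3 ^ 4 * sum (map (capacity n) (c ∷ a ∷ b ∷ []))
    ≤⟨ sum-capacity-3-large {a = c} {a} {b} (<⇒≤ (≰⇒> 2c≰n)) c≤n a≤n b≤n ⟩
  n ^ 5 * 2 ^ 4 ∎

sum-capacity-bound : ∀ {n r} (xs : List ℕ) → length xs ≡ r → r ≢ 2 → sum xs ≡ n →
  r ^ 4 * sum (map (capacity n) xs) ≤ n ^ 5 * (r ∸ 1) ^ 4
sum-capacity-bound []                      refl _   _   = z≤n
sum-capacity-bound {n} (x ∷ [])            refl _   Σ≡n = begin
  1 ^ 4 * (capacity n x + 0)  ≡⟨ trans (*-identityˡ _) (+-identityʳ _) ⟩
  capacity n x                ≡⟨ cong (capacity n) (trans (≡.sym (+-identityʳ x)) Σ≡n) ⟩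
  capacity n n                ≡⟨ capacity-self n ⟩
  0                           ≤⟨ z≤n ⟩
  n ^ 5 * 0 ^ 4               ∎
sum-capacity-bound (_ ∷ _ ∷ [])            refl r≢2 _   = ⊥-elim (r≢2 refl)
sum-capacity-bound (a ∷ b ∷ c ∷ [])        refl _   Σ≡n = sum-capacity-3 a b c Σ≡n
sum-capacity-bound xs@(_ ∷ _ ∷ _ ∷ _ ∷ ys) refl _   Σ≡n = sum-capacity-≥4 (length ys) xs refl Σ≡n

corollary4p8 : (n : ℕ) → .{{_ : NonZero n}} → (G : Graph n) →
    (∀ s → IsPhi4 G s → s ≢ 2) →
    (r : ℕ) → IsPhi G r →
    r ^ 4 * sumDeg4 G (vertices n) ≤ n ^ 5 * (r ∸ 1) ^ 4
corollary4p8 n G φ⁴≢2 r φ@((c , _ , small) , _) = begin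
  r ^ 4 * sumDeg4 G (vertices n)
    ≤⟨ *-monoʳ-≤ (r ^ 4) (sumDeg4≤sum-capacity G c small) ⟩
  r ^ 4 * sum (map (capacity n) (partSizes c))
    ≤⟨ sum-capacity-bound (partSizes c) (length-partSizes c) r≢2 (sum-partSizes c) ⟩
  n ^ 5 * (r ∸ 1) ^ 4 ∎
  where
  r≢2 : r ≢ 2
  r≢2 r≡2 = φ⁴≢2 2 (φ≡2⇒φ⁴≡2 G (subst (IsPhi G) r≡2 φ)) refl
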